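{- Let $d\geq 2$ and let $S=(V,\mathcal{H})$ be a paving simplicial complex of dimension $d$. Then the following are equivalent: (i) $S\in\mathrm{TBPav}(d)$; (ii) there exists a nonempty family $\mathcal{L}\subseteq P_{\geq d}(V)\setminus\{V\}$ such that $\mathcal{H}=\bigcup_{L\in\mathcal{L}}\mathcal{B}_d(V,L)$, where $\mathcal{B}_d(V,L)=P_{\leq d}(V)\cup\{X\in P_{d+1}(V) : |X\cap L|=d\}$.
   Context: A (finite) simplicial complex is a pair $S=(V,\mathcal{H})$ where $V$ is a finite nonempty set and $\mathcal{H}\subseteq 2^V$ contains all singletons and is closed under taking subsets. Its rank is $\max\{|I| : I\in\mathcal{H}\}$ and its dimension is rank minus one. $P_n(V)$ (resp. $P_{\leq n}(V)$, $P_{\geq n}(V)$) denotes the set of subsets of $V$ with exactly (resp. at most, at least) $n$ elements. $S$ is paving if $P_{\dim S}(V)\subseteq \mathcal{H}$. A flat of $S$ is a set $X\subseteq V$ such that $I\cup\{p\}\in\mathcal{H}$ for all $I\in\mathcal{H}\cap 2^X$ and $p\in V\setminus X$. Given a chain $F_0\subset\cdots\subset F_k$ of subsets of $V$, $X$ is a transversal of its successive differences if $X$ has an enumeration $x_1,\dots,x_k$ with $x_i\in F_i\setminus F_{i-1}$. $S$ is boolean representable (BRSC) if there is a boolean matrix $M$ with columns indexed by $V$ such that $\mathcal{H}$ is exactly the set of $X\subseteq V$ for which some square submatrix with column set $X$ is congruent (by permuting rows and columns) to a lower unitriangular boolean matrix; equivalently, $\mathcal{H}$ is the set of transversals of successive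 differences of chains of flats of $S$. For $k\geq1$, $T_k(S)=(V,\mathcal{H}\cap P_{\leq k}(V))$. $S$ is a TBRSC if $S=T_k(S')$ for some BRSC $S'$ and $k\geq 1$. $\mathrm{TBPav}(d)$ is the class of paving TBRSCs of dimension $d$. -}

module Defs where

open import Data.Nat using (ℕ; zero; suc; _≤_; _<_; _≤ᵇ_)
open import Data.Bool using (Bool; true; false; _∧_)
open import Data.Fin using (Fin; inject₁)
open import Data.Fin.Subset using (Subset; _∈_; _∉_; _⊆_; _⊂_; _∪_; _∩_; ⁅_⁆; ⊤; ∣_∣)
open import Data.Product using (Σ; ∃; ∃-syntax; _×_)
open import Data.Sum using (_⊎_)
open import Function.Definitions using (Injective)
open import Relation.Binary.PropositionalEquality using (_≡_; _≢_)
open import Function.Bundles using (_⇔_)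

record SimplicialComplex (n : ℕ) : Set where
  field
    nonempty   : 0 < n
    ℋ          : Subset n → Bool
    singletons : ∀ (v : Fin n) → ℋ ⁅ v ⁆ ≡ true
    downClosed : ∀ (X Y : Subset n) → X ⊆ Y → ℋ Y ≡ true → ℋ X ≡ true
open SimplicialComplex public

module _ {n : ℕ} (S : SimplicialComplex n) where

  HasRank : ℕ → Set
  HasRank r = (∃[ I ] (ℋ S I ≡ true × ∣ I ∣ ≡ r))
            × (∀ I → ℋ S I ≡ true → ∣ I ∣ ≤ r)

  HasDim : ℕ → Set
  HasDim d = HasRank (suc d)

  IsPavingDim : ℕ → Set
  IsPavingDim d = ∀ (X : Subset n) → ∣ X ∣ ≡ d → ℋ S X ≡ true

  IsFlat : Subset n → Set
  IsFlat X = ∀ (I : Subset n) → ℋ S I ≡ true → I ⊆ X →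
             ∀ (p : Fin n) → p ∉ X → ℋ S (I ∪ ⁅ p ⁆) ≡ true

  -- X is a transversal of the successive differences of a chain of flats
  -- F 0 ⊂ F 1 ⊂ ... ⊂ F k : X = {x_1,...,x_k} with x_i ∈ F i ∖ F (i-1).
  IsFlatTransversal : Subset n → Set
  IsFlatTransversal X =
    Σ ℕ λ k → Σ (Fin (suc k) → Subset n) λ F → Σ (Fin k → Fin n) λ x →
        (∀ (j : Fin (suc k)) → IsFlat (F j))
      × (∀ (i : Fin k) → F (inject₁ i) ⊂ F (Data.Fin.suc i))
      × Injective _≡_ _≡_ x
      × (∀ (i : Fin k) → x i ∈ F (Data.Fin.suc i) × x i ∉ F (inject₁ i))
      × (∀ (v : Fin n) → v ∈ X ⇔ (∃[ i ] x i ≡ v))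

  IsBRSC : Set
  IsBRSC = ∀ (X : Subset n) → ℋ S X ≡ true ⇔ IsFlatTransversal X

IsTruncation : ∀ {n} → SimplicialComplex n → ℕ → SimplicialComplex n → Set
IsTruncation S k S' = ∀ X → ℋ S X ≡ (ℋ S' X ∧ (∣ X ∣ ≤ᵇ k))

IsTBRSC : ∀ {n} → SimplicialComplex n → Set
IsTBRSC {n} S = Σ (SimplicialComplex n) λ S' → Σ ℕ λ k →
  1 ≤ k × IsBRSC S' × IsTruncation S k S'

InTBPav : ∀ {n} → ℕ → SimplicialComplex n → Set
InTBPav d S = IsPavingDim S d × IsTBRSC S × HasDim S d

InB : ∀ {n} → ℕ → Subset n → Subset n → Set
InB d L X = ∣ X ∣ ≤ d ⊎ (∣ X ∣ ≡ suc d × ∣ X ∩ L ∣ ≡ d)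

HasBDecomposition : ∀ {n} → ℕ → SimplicialComplex n → Set
HasBDecomposition {n} d S = Σ (Subset n → Bool) λ 𝓛 →
    (∃[ L ] 𝓛 L ≡ true)
  × (∀ L → 𝓛 L ≡ true → d ≤ ∣ L ∣ × L ≢ ⊤)
  × (∀ X → ℋ S X ≡ true ⇔ (∃[ L ] (𝓛 L ≡ true × InB d L X)))

-- (i) ⇒ (ii): let 𝓛 consist of the proper subsets L with |L| ≥ d such that J ∪ {p} ∈ ℋ
-- whenever J ⊆ L has d elements and p ∉ L.  A face X with d + 1 elements is a face of the
-- boolean representable S′ with S = T_K(S′), hence a transversal of a chain of flats of S′;
-- the penultimate flat L contains X except for its last element, and flatness of L in S′
-- (together with paving) puts L in 𝓛.
--
-- (ii) ⇒ (i): let cl A = A when |A| < d, and otherwise the intersection of the members of 𝓛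
-- containing A.  The sets whose elements can be removed one at a time, each outside the
-- closure of those remaining, form a boolean representable complex: closed sets are flats,
-- and an independent set is a transversal of the chain of closures of its initial segments.
-- Truncated at d + 1 this complex is ⋃_{L∈𝓛} B_d(V,L) = S.

module Submission where

open import Data.Bool using (Bool; true; false; T)
open import Data.Bool.Properties using (T-≡; T-∧) renaming (_≟_ to _≟ᵇ_)
open import Data.Fin using (Fin; zero; suc; fromℕ; inject₁)
open import Data.Fin.Properties using (any?; all?) renaming (_≟_ to _≟ᶠ_)
open import Data.Fin.Relation.Unary.Top using (view; ‵fromℕ; ‵inj₁)
open import Data.Fin.Subset
open import Data.Fin.Subset.Induction using (⊂-wellFounded; Acc; acc)
open import Data.Fin.Subset.Properties
open import Data.Nat using (ℕ; zero; suc; _+_; _∸_; _≤_; _<_; _≤?_; _<?_; z≤n; s≤s)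
open import Data.Nat.Properties
open import Data.Product using (Σ; ∃; _×_; _,_; proj₁; proj₂)
open import Data.Sum using (_⊎_; inj₁; inj₂)
open import Data.Vec using (_∷_; here; there; tabulate)
open import Data.Vec.Properties using (≡-dec; lookup∘tabulate; []=⇒lookup; lookup⇒[]=)
open import Function using (_∘_)
open import Function.Bundles using (_⇔_; mk⇔; Equivalence)
open import Function.Definitions using (Injective)
open import Relation.Binary.PropositionalEquality
  using (_≡_; _≢_; refl; sym; trans; cong; subst)
open import Relation.Nullary using (Dec; yes; no; does; contradiction)
open import Relation.Nullary.Decidable
  using (map′; ¬?; _×-dec_; _⊎-dec_; _→-dec_; T?; dec-true; does-⇔; decidable-stable)

open import Defs

open Equivalence using (to; from)

private
  variable
    n : ℕ
    p q : Subset n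
    x y : Fin n

-- Cardinalities of finite subsets

x∈p⇒suc∣p-x∣≡∣p∣ : x ∈ p → suc ∣ p - x ∣ ≡ ∣ p ∣
x∈p⇒suc∣p-x∣≡∣p∣ {p = true ∷ p} here = cong (suc ∘ ∣_∣) (p─⊥≡p p)
x∈p⇒suc∣p-x∣≡∣p∣ {p = true ∷ p} (there x∈p) = cong suc (x∈p⇒suc∣p-x∣≡∣p∣ x∈p)
x∈p⇒suc∣p-x∣≡∣p∣ {p = false ∷ p} (there x∈p) = x∈p⇒suc∣p-x∣≡∣p∣ x∈p

x∉p⇒∣p∪⁅x⁆∣≡suc∣p∣ : ∀ {n} {p : Subset n} {x} → x ∉ p → ∣ p ∪ ⁅ x ⁆ ∣ ≡ suc ∣ p ∣
x∉p⇒∣p∪⁅x⁆∣≡suc∣p∣ {p = false ∷ p} {x = zero} _ = cong (suc ∘ ∣_∣) (∪-identityʳ p)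
x∉p⇒∣p∪⁅x⁆∣≡suc∣p∣ {p = true ∷ p} {x = zero} x∉p = contradiction here x∉p
x∉p⇒∣p∪⁅x⁆∣≡suc∣p∣ {p = false ∷ p} {x = suc x} x∉p = x∉p⇒∣p∪⁅x⁆∣≡suc∣p∣ (x∉p ∘ there)
x∉p⇒∣p∪⁅x⁆∣≡suc∣p∣ {p = true ∷ p} {x = suc x} x∉p = cong suc (x∉p⇒∣p∪⁅x⁆∣≡suc∣p∣ (x∉p ∘ there))

Empty⇒∣p∣≡0 : ∀ {n} {p : Subset n} → Empty p → ∣ p ∣ ≡ 0
Empty⇒∣p∣≡0 {n} e = trans (cong ∣_∣ (Empty-unique e)) (∣⊥∣≡0 n)

0<∣p∣⇒Nonempty : 0 < ∣ p ∣ → Nonempty p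
0<∣p∣⇒Nonempty {p = p} 0<∣p∣ =
  decidable-stable (nonempty? p) (λ e → <⇒≢ 0<∣p∣ (sym (Empty⇒∣p∣≡0 e)))

∣p∣<n⇒∃∉ : ∀ {n} {p : Subset n} → ∣ p ∣ < n → ∃ λ x → x ∉ p
∣p∣<n⇒∃∉ {n = n} {p = p} ∣p∣<n with any? (λ x → ¬? (x ∈? p))
... | yes x∉p = x∉p
... | no ∄x∉p = contradiction (p⊆q⇒∣p∣≤∣q∣ ⊤⊆p) (<⇒≱ (subst (∣ p ∣ <_) (sym (∣⊤∣≡n n)) ∣p∣<n))
  where
  ⊤⊆p : ⊤ ⊆ p
  ⊤⊆p {x} _ = decidable-stable (x ∈? p) (λ x∉p → ∄x∉p (x , x∉p))

p⊆q∧∣q∣≤∣p∣⇒q⊆p : p ⊆ q → ∣ q ∣ ≤ ∣ p ∣ → q ⊆ p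
p⊆q∧∣q∣≤∣p∣⇒q⊆p {p = p} p⊆q ∣q∣≤∣p∣ {x} x∈q =
  decidable-stable (x ∈? p) (λ x∉p → <⇒≱ (p⊂q⇒∣p∣<∣q∣ (p⊆q , x , x∈q , x∉p)) ∣q∣≤∣p∣)

x∉p-x : ∀ {n} {p : Subset n} {x} → x ∉ p - x
x∉p-x {p = s ∷ p} {x = zero} ()
x∉p-x {p = s ∷ p} {x = suc x} (there x∈p-x) = x∉p-x x∈p-x

x∈p-y⇒x≢y : x ∈ p - y → x ≢ y
x∈p-y⇒x≢y x∈p-y refl = x∉p-x x∈p-y

p∪⁅x⁆-x⊆p : (p ∪ ⁅ x ⁆) - x ⊆ p
p∪⁅x⁆-x⊆p {p = p} {x} y∈ with x∈p∪q⁻ p ⁅ x ⁆ (p─q⊆p _ _ y∈)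
... | inj₁ y∈p = y∈p
... | inj₂ y∈⁅x⁆ = contradiction (x∈⁅y⁆⇒x≡y x y∈⁅x⁆) (x∈p-y⇒x≢y y∈)

p⊆p-x∪⁅x⁆ : ∀ {n} {p : Subset n} {x} → p ⊆ (p - x) ∪ ⁅ x ⁆
p⊆p-x∪⁅x⁆ {_} {_} {x} {y} y∈p with y ≟ᶠ x
... | yes refl = x∈p∪q⁺ (inj₂ (x∈⁅x⁆ x))
... | no y≢x = x∈p∪q⁺ (inj₁ (x∈p∧x≢y⇒x∈p-y y∈p y≢x))

x∈p∧∣p∣≡1+m⇒∣p-x∣≡m : ∀ {m} → x ∈ p → ∣ p ∣ ≡ suc m → ∣ p - x ∣ ≡ m
x∈p∧∣p∣≡1+m⇒∣p-x∣≡m x∈p ∣p∣≡ = suc-injective (trans (x∈p⇒suc∣p-x∣≡∣p∣ x∈p) ∣p∣≡)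

x∉q⇒p∩q⊆p-x : x ∉ q → p ∩ q ⊆ p - x
x∉q⇒p∩q⊆p-x {q = q} {p = p} x∉q y∈ =
  x∈p∧x≢y⇒x∈p-y (p∩q⊆p p q y∈) (λ { refl → x∉q (p∩q⊆q p q y∈) })

x∉q∧p-x⊆q⇒∣p∩q∣≡∣p-x∣ : x ∉ q → p - x ⊆ q → ∣ p ∩ q ∣ ≡ ∣ p - x ∣
x∉q∧p-x⊆q⇒∣p∩q∣≡∣p-x∣ x∉q p-x⊆q =
  cong ∣_∣ (⊆-antisym (x∉q⇒p∩q⊆p-x x∉q) (λ y∈ → x∈p∩q⁺ (p─q⊆p _ _ y∈ , p-x⊆q y∈)))

∣p∣≡suc∣p∩q∣⇒∃x,p-x⊆q : ∣ p ∣ ≡ suc ∣ p ∩ q ∣ → ∃ λ x → x ∈ p × x ∉ q × p - x ⊆ q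
∣p∣≡suc∣p∩q∣⇒∃x,p-x⊆q {p = p} {q = q} ∣p∣≡ with any? (λ x → (x ∈? p) ×-dec ¬? (x ∈? q))
... | yes (x , x∈p , x∉q) = x , x∈p , x∉q , p∩q⊆q p q ∘ p∩q⊇p-x
  where
  p∩q⊇p-x : p - x ⊆ p ∩ q
  p∩q⊇p-x = p⊆q∧∣q∣≤∣p∣⇒q⊆p (x∉q⇒p∩q⊆p-x x∉q) (≤-reflexive (x∈p∧∣p∣≡1+m⇒∣p-x∣≡m x∈p ∣p∣≡))
... | no ∄x = contradiction (p⊆q⇒∣p∣≤∣q∣ p⊆p∩q) (<⇒≱ (≤-reflexive (sym ∣p∣≡)))
  where
  p⊆p∩q : p ⊆ p ∩ q
  p⊆p∩q {x} x∈p = x∈p∩q⁺ (x∈p , decidable-stable (x ∈? q) (λ x∉q → ∄x (x , x∈p , x∉q)))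

⊆-superset-of-size : ∀ {n} {p : Subset n} g → ∣ p ∣ + g ≤ n → ∃ λ q → p ⊆ q × ∣ q ∣ ≡ ∣ p ∣ + g
⊆-superset-of-size {p = p} zero _ = p , (λ x∈p → x∈p) , sym (+-identityʳ _)
⊆-superset-of-size {n} {p} (suc g) bound =
  let x , x∉p = ∣p∣<n⇒∃∉ {p = p} (≤-trans (m<m+n ∣ p ∣ (s≤s z≤n)) bound)
      ∣p∪x∣≡ = x∉p⇒∣p∪⁅x⁆∣≡suc∣p∣ x∉p
      q , p∪x⊆q , ∣q∣≡ = ⊆-superset-of-size {p = p ∪ ⁅ x ⁆} g
        (subst (λ m → m + g ≤ n) (sym ∣p∪x∣≡) (subst (_≤ n) (+-suc ∣ p ∣ g) bound))
  in q , p∪x⊆q ∘ x∈p∪q⁺ ∘ inj₁ , trans ∣q∣≡ (trans (cong (_+ g) ∣p∪x∣≡) (sym (+-suc ∣ p ∣ g)))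

all-subsets? : ∀ {n} {P : Subset n → Set} → (∀ p → Dec (P p)) → Dec (∀ p → P p)
all-subsets? {P = P} P? with anySubset? (λ p → ¬? (P? p))
... | yes (p , ¬Pp) = no (λ ∀P → ¬Pp (∀P p))
... | no ∄¬P = yes (λ p → decidable-stable (P? p) (λ ¬Pp → ∄¬P (p , ¬Pp)))

does≡true⇒ : ∀ {A : Set} (a? : Dec A) → does a? ≡ true → A
does≡true⇒ (yes a) _ = a

-- Chains of flats and their transversals

snoc : ∀ {A : Set} {m} → (Fin m → A) → A → Fin (suc m) → A
snoc {m = zero} f a zero = a
snoc {m = suc m} f a zero = f zero
snoc {m = suc m} f a (suc i) = snoc (f ∘ suc) a i

snoc-inject₁ : ∀ {A : Set} {m} (f : Fin m → A) a i → snoc f a (inject₁ i) ≡ f i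
snoc-inject₁ {m = suc m} f a zero = refl
snoc-inject₁ {m = suc m} f a (suc i) = snoc-inject₁ (f ∘ suc) a i

snoc-fromℕ : ∀ {A : Set} {m} (f : Fin m → A) a → snoc f a (fromℕ m) ≡ a
snoc-fromℕ {m = zero} f a = refl
snoc-fromℕ {m = suc m} f a = snoc-fromℕ (f ∘ suc) a

snoc-injective : ∀ {A : Set} {m} {f : Fin m → A} {a} →
  Injective _≡_ _≡_ f → (∀ i → f i ≢ a) → Injective _≡_ _≡_ (snoc f a)
snoc-injective {f = f} {a} f-inj f≢a {i} {i′} eq with view i | view i′
... | ‵fromℕ | ‵fromℕ = refl
... | ‵fromℕ | ‵inj₁ {i = j} _ rewrite snoc-fromℕ f a | snoc-inject₁ f a j =
  contradiction (sym eq) (f≢a j)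
... | ‵inj₁ {i = j} _ | ‵fromℕ rewrite snoc-fromℕ f a | snoc-inject₁ f a j =
  contradiction eq (f≢a j)
... | ‵inj₁ {i = j} _ | ‵inj₁ {i = j′} _ rewrite snoc-inject₁ f a j | snoc-inject₁ f a j′ =
  cong inject₁ (f-inj eq)

chain-⊆-top : ∀ {n} m (F : Fin (suc m) → Subset n) → (∀ i → F (inject₁ i) ⊆ F (suc i)) →
              ∀ j → F j ⊆ F (fromℕ m)
chain-⊆-top zero F F⊆ zero = λ x∈ → x∈
chain-⊆-top (suc m) F F⊆ zero = chain-⊆-top m (F ∘ suc) (F⊆ ∘ suc) zero ∘ F⊆ zero
chain-⊆-top (suc m) F F⊆ (suc j) = chain-⊆-top m (F ∘ suc) (F⊆ ∘ suc) j

∅∈ℋ : ∀ {n} (S : SimplicialComplex n) → ℋ S ⊥ ≡ true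
∅∈ℋ {zero} S = contradiction (nonempty S) λ ()
∅∈ℋ {suc n} S = downClosed S ⊥ ⁅ zero ⁆ (⊆-min _) (singletons S zero)

module _ {n} (S : SimplicialComplex n) where

  flatChain-extends-face : ∀ k (F : Fin (suc k) → Subset n) (x : Fin k → Fin n) →
    (∀ j → IsFlat S (F j)) → (∀ i → F (inject₁ i) ⊆ F (suc i)) →
    (∀ i → x i ∈ F (suc i) × x i ∉ F (inject₁ i)) →
    ∀ {I X} → ℋ S I ≡ true → I ⊆ F zero →
    (∀ {v} → v ∈ X → v ∈ I ⊎ ∃ λ i → x i ≡ v) → ℋ S X ≡ true
  flatChain-extends-face zero F x _ _ _ {I} {X} I∈ℋ _ X⊆I∪x = downClosed S X I X⊆I I∈ℋ
    where
    X⊆I : X ⊆ I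
    X⊆I v∈X with X⊆I∪x v∈X
    ... | inj₁ v∈I = v∈I
    ... | inj₂ (() , _)
  flatChain-extends-face (suc k) F x F-flat F⊆ x∈F {I} {X} I∈ℋ I⊆F₀ X⊆I∪x =
    flatChain-extends-face k (F ∘ suc) (x ∘ suc) (F-flat ∘ suc) (F⊆ ∘ suc) (x∈F ∘ suc)
      (F-flat zero I I∈ℋ I⊆F₀ (x zero) (proj₂ (x∈F zero))) I∪x₀⊆F₁ X⊆I∪x₀∪x
    where
    I∪x₀⊆F₁ : I ∪ ⁅ x zero ⁆ ⊆ F (suc zero)
    I∪x₀⊆F₁ v∈ with x∈p∪q⁻ I ⁅ x zero ⁆ v∈
    ... | inj₁ v∈I = F⊆ zero (I⊆F₀ v∈I)
    ... | inj₂ v∈⁅x₀⁆ rewrite x∈⁅y⁆⇒x≡y (x zero) v∈⁅x₀⁆ = proj₁ (x∈F zero)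
    X⊆I∪x₀∪x : ∀ {v} → v ∈ X → v ∈ I ∪ ⁅ x zero ⁆ ⊎ ∃ λ i → x (suc i) ≡ v
    X⊆I∪x₀∪x v∈X with X⊆I∪x v∈X
    ... | inj₁ v∈I = inj₁ (x∈p∪q⁺ (inj₁ v∈I))
    ... | inj₂ (zero , refl) = inj₁ (x∈p∪q⁺ (inj₂ (x∈⁅x⁆ (x zero))))
    ... | inj₂ (suc i , x≡v) = inj₂ (i , x≡v)

  IsFlatTransversal⇒ℋ : ∀ X → IsFlatTransversal S X → ℋ S X ≡ true
  IsFlatTransversal⇒ℋ X (k , F , x , F-flat , F⊂ , _ , x∈F , X⇔x) =
    flatChain-extends-face k F x F-flat (proj₁ ∘ F⊂) x∈F (∅∈ℋ S) (⊆-min _) (inj₂ ∘ to (X⇔x _))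

  topFlat : ∀ {X} → IsFlatTransversal S X → Subset n
  topFlat (k , F , _) = F (fromℕ k)

  transversal-last : ∀ {X} → IsFlatTransversal S X → Nonempty X →
    ∃ λ L → ∃ λ y → IsFlat S L × y ∈ X × y ∉ L × X - y ⊆ L
  transversal-last (zero , _ , _ , _ , _ , _ , _ , X⇔x) (v , v∈X) with to (X⇔x v) v∈X
  ... | () , _
  transversal-last {X} (suc m , F , x , F-flat , F⊂ , _ , x∈F , X⇔x) _ =
    F (inject₁ (fromℕ m)) , x (fromℕ m) , F-flat _ , from (X⇔x _) (_ , refl) , proj₂ (x∈F _) , X-y⊆L
    where
    X-y⊆L : X - x (fromℕ m) ⊆ F (inject₁ (fromℕ m))
    X-y⊆L {v} v∈ with to (X⇔x v) (p─q⊆p _ _ v∈)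
    ... | i , refl with view i
    ... | ‵fromℕ = contradiction refl (x∈p-y⇒x≢y v∈)
    ... | ‵inj₁ {i = j} _ =
      chain-⊆-top m (F ∘ inject₁) (proj₁ ∘ F⊂ ∘ inject₁) (suc j) (proj₁ (x∈F (inject₁ j)))

  transversal-empty : ∀ {X G} → IsFlat S G → Empty X →
    Σ (IsFlatTransversal S X) λ t → topFlat t ≡ G
  transversal-empty {G = G} G-flat X-empty =
    (0 , (λ _ → G) , (λ ()) , (λ _ → G-flat) , (λ ()) , (λ { {()} }) , (λ ()) ,
      λ v → mk⇔ (λ v∈X → contradiction (v , v∈X) X-empty) (λ { (() , _) })) , refl

  transversal-snoc : ∀ {X y G} (t : IsFlatTransversal S (X - y)) → y ∈ X →
    IsFlat S G → topFlat t ⊆ G → y ∈ G → y ∉ topFlat t →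
    Σ (IsFlatTransversal S X) λ t′ → topFlat t′ ≡ G
  transversal-snoc {X} {y} {G} (k , F , x , F-flat , F⊂ , x-inj , x∈F , X-y⇔x)
                   y∈X G-flat top⊆G y∈G y∉top =
    ( suc k , snoc F G , snoc x y , flat , chain
    , snoc-injective x-inj (x∈p-y⇒x≢y ∘ x∈X-y) , member , X⇔x′ )
    , snoc-fromℕ F G
    where
    x∈X-y : ∀ i → x i ∈ X - y
    x∈X-y i = from (X-y⇔x _) (i , refl)
    flat : ∀ j → IsFlat S (snoc F G j)
    flat j with view j
    ... | ‵fromℕ rewrite snoc-fromℕ F G = G-flat
    ... | ‵inj₁ {i = i} _ rewrite snoc-inject₁ F G i = F-flat i
    chain : ∀ i → snoc F G (inject₁ i) ⊂ snoc F G (suc i)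
    chain i with view i
    ... | ‵fromℕ rewrite snoc-inject₁ F G (fromℕ k) | snoc-fromℕ F G = top⊆G , y , y∈G , y∉top
    ... | ‵inj₁ {i = j} _ rewrite snoc-inject₁ F G (inject₁ j) | snoc-inject₁ F G (suc j) = F⊂ j
    member : ∀ i → snoc x y i ∈ snoc F G (suc i) × snoc x y i ∉ snoc F G (inject₁ i)
    member i with view i
    ... | ‵fromℕ rewrite snoc-fromℕ x y | snoc-inject₁ F G (fromℕ k) | snoc-fromℕ F G = y∈G , y∉top
    ... | ‵inj₁ {i = j} _
      rewrite snoc-inject₁ x y j | snoc-inject₁ F G (inject₁ j) | snoc-inject₁ F G (suc j) = x∈F j
    X⇔x′ : ∀ v → v ∈ X ⇔ (∃ λ i → snoc x y i ≡ v)
    X⇔x′ v = mk⇔ enumerate enumerated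
      where
      enumerate : v ∈ X → ∃ λ i → snoc x y i ≡ v
      enumerate v∈X with v ≟ᶠ y
      ... | yes refl = fromℕ k , snoc-fromℕ x y
      ... | no v≢y with to (X-y⇔x v) (x∈p∧x≢y⇒x∈p-y v∈X v≢y)
      ... | j , xj≡v = inject₁ j , trans (snoc-inject₁ x y j) xj≡v
      enumerated : (∃ λ i → snoc x y i ≡ v) → v ∈ X
      enumerated (i , refl) with view i
      ... | ‵fromℕ rewrite snoc-fromℕ x y = y∈X
      ... | ‵inj₁ {i = j} _ rewrite snoc-inject₁ x y j = p─q⊆p _ _ (x∈X-y j)

  paving⇒small-faces : ∀ {d X} → IsPavingDim S d → d ≤ n → ∣ X ∣ ≤ d → ℋ S X ≡ true
  paving⇒small-faces {d} {X} pav d≤n ∣X∣≤d =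
    let Y , X⊆Y , ∣Y∣≡ = ⊆-superset-of-size {p = X} (d ∸ ∣ X ∣)
                           (subst (_≤ n) (sym (m+[n∸m]≡n ∣X∣≤d)) d≤n)
    in downClosed S X Y X⊆Y (pav Y (trans ∣Y∣≡ (m+[n∸m]≡n ∣X∣≤d)))

module _ {n K : ℕ} (S S′ : SimplicialComplex n) where

  IsTruncation⇒⇔ : IsTruncation S K S′ → ∀ X → ℋ S X ≡ true ⇔ (ℋ S′ X ≡ true × ∣ X ∣ ≤ K)
  IsTruncation⇒⇔ trunc X = mk⇔
    (λ X∈ℋ → let X∈ℋ′ , ∣X∣≤K = to T-∧ (from T-≡ (trans (sym (trunc X)) X∈ℋ))
             in to T-≡ X∈ℋ′ , ≤ᵇ⇒≤ _ _ ∣X∣≤K)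
    (λ (X∈ℋ′ , ∣X∣≤K) → trans (trunc X) (to T-≡ (from T-∧ (from T-≡ X∈ℋ′ , ≤⇒≤ᵇ ∣X∣≤K))))

  ⇔⇒IsTruncation : (∀ X → ℋ S X ≡ true ⇔ (ℋ S′ X ≡ true × ∣ X ∣ ≤ K)) → IsTruncation S K S′
  ⇔⇒IsTruncation ℋ⇔ X = does-⇔ T⇔ (T? (ℋ S X)) (T? (ℋ S′ X) ×-dec (∣ X ∣ ≤? K))
    where
    T⇔ : T (ℋ S X) ⇔ (T (ℋ S′ X) × ∣ X ∣ ≤ K)
    T⇔ = mk⇔ (λ X∈ℋ → let X∈ℋ′ , ∣X∣≤K = to (ℋ⇔ X) (to T-≡ X∈ℋ) in from T-≡ X∈ℋ′ , ∣X∣≤K)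
             (λ (X∈ℋ′ , ∣X∣≤K) → from T-≡ (from (ℋ⇔ X) (to T-≡ X∈ℋ′ , ∣X∣≤K)))

-- The independence complex of a closure operator

module ClosureComplex {n} (0<n : 0 < n) (cl : Subset n → Subset n)
  (cl-extensive : ∀ {A} → A ⊆ cl A)
  (cl-monotone : ∀ {A B} → A ⊆ B → cl A ⊆ cl B)
  (cl-idempotent : ∀ {A} → cl (cl A) ⊆ cl A)
  (∉cl⊥ : ∀ {v} → v ∉ cl ⊥) where

  data Independent : Subset n → Set where
    empty : ∀ {X} → Empty X → Independent X
    step  : ∀ {X x} → x ∈ X → x ∉ cl (X - x) → Independent (X - x) → Independent X

  independent? : ∀ X → Dec (Independent X)
  independent? X = decide X (⊂-wellFounded X)
    where
    decide : ∀ X → Acc _⊂_ X → Dec (Independent X)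
    decide X (acc smaller) = map′ build inspect (¬? (nonempty? X) ⊎-dec any? removable?)
      where
      removable? : ∀ x → Dec (x ∈ X × x ∉ cl (X - x) × Independent (X - x))
      removable? x with x ∈? X
      ... | no x∉X = no (x∉X ∘ proj₁)
      ... | yes x∈X = map′ (x∈X ,_) proj₂
        (¬? (x ∈? cl (X - x)) ×-dec decide (X - x) (smaller (x∈p⇒p-x⊂p x∈X)))
      build : Empty X ⊎ (∃ λ x → x ∈ X × x ∉ cl (X - x) × Independent (X - x)) → Independent X
      build (inj₁ X-empty) = empty X-empty
      build (inj₂ (_ , x∈X , x∉cl , X-x-ind)) = step x∈X x∉cl X-x-ind
      inspect : Independent X → Empty X ⊎ (∃ λ x → x ∈ X × x ∉ cl (X - x) × Independent (X - x))
      inspect (empty X-empty) = inj₁ X-empty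
      inspect (step x∈X x∉cl X-x-ind) = inj₂ (_ , x∈X , x∉cl , X-x-ind)

  independent-antitone : ∀ {X Y} → Y ⊆ X → Independent X → Independent Y
  independent-antitone Y⊆X (empty X-empty) = empty (λ (v , v∈Y) → X-empty (v , Y⊆X v∈Y))
  independent-antitone {X} {Y} Y⊆X (step {x = x} x∈X x∉cl X-x-ind) with x ∈? Y
  ... | yes x∈Y = step x∈Y (x∉cl ∘ cl-monotone Y-x⊆X-x) (independent-antitone Y-x⊆X-x X-x-ind)
    where
    Y-x⊆X-x : Y - x ⊆ X - x
    Y-x⊆X-x v∈ = x∈p∧x≢y⇒x∈p-y (Y⊆X (p─q⊆p _ _ v∈)) (x∈p-y⇒x≢y v∈)
  ... | no x∉Y = independent-antitone Y⊆X-x X-x-ind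
    where
    Y⊆X-x : Y ⊆ X - x
    Y⊆X-x v∈Y = x∈p∧x≢y⇒x∈p-y (Y⊆X v∈Y) (λ { refl → x∉Y v∈Y })

  independent-∪ : ∀ {I x} → Independent I → x ∉ cl I → Independent (I ∪ ⁅ x ⁆)
  independent-∪ {x = x} I-ind x∉cl = step (x∈p∪q⁺ (inj₂ (x∈⁅x⁆ x)))
    (x∉cl ∘ cl-monotone p∪⁅x⁆-x⊆p) (independent-antitone p∪⁅x⁆-x⊆p I-ind)

  complex : SimplicialComplex n
  complex = record
    { nonempty   = 0<n
    ; ℋ          = does ∘ independent?
    ; singletons = λ v → dec-true (independent? _)
        (independent-antitone (x∈p∪q⁺ ∘ inj₂) (independent-∪ (empty λ (_ , v∈⊥) → ∉⊥ v∈⊥) ∉cl⊥))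
    ; downClosed = λ X Y X⊆Y Y∈ℋ → dec-true (independent? X)
        (independent-antitone X⊆Y (does≡true⇒ (independent? Y) Y∈ℋ))
    }

  ℋ⇔Independent : ∀ X → ℋ complex X ≡ true ⇔ Independent X
  ℋ⇔Independent X = mk⇔ (does≡true⇒ (independent? X)) (dec-true (independent? X))

  cl-IsFlat : ∀ A → IsFlat complex (cl A)
  cl-IsFlat A I I∈ℋ I⊆clA p p∉clA = from (ℋ⇔Independent _)
    (independent-∪ (to (ℋ⇔Independent I) I∈ℋ) (p∉clA ∘ cl-idempotent ∘ cl-monotone I⊆clA))

  Independent⇒transversal : ∀ {X} → Independent X →
    Σ (IsFlatTransversal complex X) λ t → topFlat complex t ⊆ cl X
  Independent⇒transversal {X} (empty X-empty) =
    let t , top≡ = transversal-empty complex (cl-IsFlat X) X-empty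
    in t , ⊆-reflexive top≡
  Independent⇒transversal {X} (step x∈X x∉cl X-x-ind) =
    let t , top⊆ = Independent⇒transversal X-x-ind
        t′ , top≡ = transversal-snoc complex t x∈X (cl-IsFlat X)
          (cl-monotone (p─q⊆p _ _) ∘ top⊆) (cl-extensive x∈X) (x∉cl ∘ top⊆)
    in t′ , ⊆-reflexive top≡

  complex-IsBRSC : IsBRSC complex
  complex-IsBRSC X = mk⇔ (proj₁ ∘ Independent⇒transversal ∘ to (ℋ⇔Independent X))
                         (IsFlatTransversal⇒ℋ complex X)

module TBRSC⇒BDecomposition {n d} (S : SimplicialComplex n)
  (pav : IsPavingDim S d) (dim : HasDim S d)
  (S′ : SimplicialComplex n) (K : ℕ) (S′-brsc : IsBRSC S′) (trunc : IsTruncation S K S′) where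

  -- Given paving, Extending L says that B_d(V, L) ⊆ ℋ.
  Extending : Subset n → Set
  Extending L = d ≤ ∣ L ∣ × L ≢ ⊤ ×
    (∀ J → J ⊆ L → ∣ J ∣ ≡ d → ∀ p → p ∉ L → ℋ S (J ∪ ⁅ p ⁆) ≡ true)

  extending? : ∀ L → Dec (Extending L)
  extending? L = (d ≤? ∣ L ∣) ×-dec ¬? (≡-dec _≟ᵇ_ L ⊤) ×-dec all-subsets? λ J →
    (J ⊆? L) →-dec (∣ J ∣ ≟ d) →-dec all? λ p → ¬? (p ∈? L) →-dec (ℋ S (J ∪ ⁅ p ⁆) ≟ᵇ true)

  ℋ⇔ : ∀ X → ℋ S X ≡ true ⇔ (ℋ S′ X ≡ true × ∣ X ∣ ≤ K)
  ℋ⇔ = IsTruncation⇒⇔ S S′ trunc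

  suc-d≤K : suc d ≤ K
  suc-d≤K = let I , I∈ℋ , ∣I∣≡ = proj₁ dim in subst (_≤ K) ∣I∣≡ (proj₂ (to (ℋ⇔ I) I∈ℋ))

  d≤n : d ≤ n
  d≤n = let I , _ , ∣I∣≡ = proj₁ dim in ≤-trans (n≤1+n d) (subst (_≤ n) ∣I∣≡ (∣p∣≤n I))

  face⇒Extending : ∀ X → ℋ S X ≡ true → ∣ X ∣ ≡ suc d → ∃ λ L → Extending L × ∣ X ∩ L ∣ ≡ d
  face⇒Extending X X∈ℋ ∣X∣≡ with transversal-last S′ (to (S′-brsc X) (proj₁ (to (ℋ⇔ X) X∈ℋ)))
                                   (0<∣p∣⇒Nonempty (subst (0 <_) (sym ∣X∣≡) (s≤s z≤n)))
  ... | L , y , L-flat , y∈X , y∉L , X-y⊆L = L , (d≤∣L∣ , L≢⊤ , extends) , ∣X∩L∣≡d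
    where
    ∣X-y∣≡d : ∣ X - y ∣ ≡ d
    ∣X-y∣≡d = x∈p∧∣p∣≡1+m⇒∣p-x∣≡m y∈X ∣X∣≡
    d≤∣L∣ : d ≤ ∣ L ∣
    d≤∣L∣ = subst (_≤ ∣ L ∣) ∣X-y∣≡d (p⊆q⇒∣p∣≤∣q∣ X-y⊆L)
    L≢⊤ : L ≢ ⊤
    L≢⊤ refl = y∉L ∈⊤
    extends : ∀ J → J ⊆ L → ∣ J ∣ ≡ d → ∀ p → p ∉ L → ℋ S (J ∪ ⁅ p ⁆) ≡ true
    extends J J⊆L ∣J∣≡d p p∉L = from (ℋ⇔ _)
      ( L-flat J (proj₁ (to (ℋ⇔ J) (pav J ∣J∣≡d))) J⊆L p p∉L
      , subst (_≤ K) (sym (trans (x∉p⇒∣p∪⁅x⁆∣≡suc∣p∣ (p∉L ∘ J⊆L)) (cong suc ∣J∣≡d))) suc-d≤K)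
    ∣X∩L∣≡d : ∣ X ∩ L ∣ ≡ d
    ∣X∩L∣≡d = trans (x∉q∧p-x⊆q⇒∣p∩q∣≡∣p-x∣ y∉L X-y⊆L) ∣X-y∣≡d

  B⊆ℋ : ∀ {L X} → Extending L → InB d L X → ℋ S X ≡ true
  B⊆ℋ _ (inj₁ ∣X∣≤d) = paving⇒small-faces S pav d≤n ∣X∣≤d
  B⊆ℋ {L} {X} (_ , _ , extends) (inj₂ (∣X∣≡ , ∣X∩L∣≡)) =
    let p , p∈X , p∉L , X-p⊆L = ∣p∣≡suc∣p∩q∣⇒∃x,p-x⊆q (trans ∣X∣≡ (cong suc (sym ∣X∩L∣≡)))
    in downClosed S X _ p⊆p-x∪⁅x⁆ (extends (X - p) X-p⊆L (x∈p∧∣p∣≡1+m⇒∣p-x∣≡m p∈X ∣X∣≡) p p∉L)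

  ℋ⊆⋃B : ∀ {L₀} → Extending L₀ → ∀ {X} → ℋ S X ≡ true → ∃ λ L → Extending L × InB d L X
  ℋ⊆⋃B L₀-extending {X} X∈ℋ with m≤n⇒m<n∨m≡n (proj₂ dim X X∈ℋ)
  ... | inj₁ (s≤s ∣X∣≤d) = _ , L₀-extending , inj₁ ∣X∣≤d
  ... | inj₂ ∣X∣≡ = let L , L-extending , ∣X∩L∣≡ = face⇒Extending X X∈ℋ ∣X∣≡
                    in L , L-extending , inj₂ (∣X∣≡ , ∣X∩L∣≡)

  decomposition : HasBDecomposition d S
  decomposition =
    let I , I∈ℋ , ∣I∣≡ = proj₁ dim
        L₀ , L₀-extending , _ = face⇒Extending I I∈ℋ ∣I∣≡
    in 𝓛 , (L₀ , dec-true (extending? L₀) L₀-extending) , 𝓛⊆proper ,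
       λ X → mk⇔ (λ X∈ℋ → let L , L-extending , X∈B = ℋ⊆⋃B L₀-extending X∈ℋ
                           in L , dec-true (extending? L) L-extending , X∈B)
                 (λ (L , L∈𝓛 , X∈B) → B⊆ℋ (does≡true⇒ (extending? L) L∈𝓛) X∈B)
    where
    𝓛 : Subset n → Bool
    𝓛 = does ∘ extending?
    𝓛⊆proper : ∀ L → 𝓛 L ≡ true → d ≤ ∣ L ∣ × L ≢ ⊤
    𝓛⊆proper L L∈𝓛 = let d≤∣L∣ , L≢⊤ , _ = does≡true⇒ (extending? L) L∈𝓛 in d≤∣L∣ , L≢⊤

module BDecomposition⇒TBRSC {n d} (S : SimplicialComplex n) (1≤d : 1 ≤ d)
  (𝓛 : Subset n → Bool) {L₀} (L₀∈𝓛 : 𝓛 L₀ ≡ true)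
  (ℋ⇔⋃B : ∀ X → ℋ S X ≡ true ⇔ (∃ λ L → 𝓛 L ≡ true × InB d L X)) where

  InClosure : Subset n → Fin n → Set
  InClosure A v = (∣ A ∣ < d × v ∈ A) ⊎ (d ≤ ∣ A ∣ × (∀ L → 𝓛 L ≡ true → A ⊆ L → v ∈ L))

  inClosure? : ∀ A v → Dec (InClosure A v)
  inClosure? A v = ((∣ A ∣ <? d) ×-dec (v ∈? A)) ⊎-dec ((d ≤? ∣ A ∣) ×-dec
    all-subsets? λ L → (𝓛 L ≟ᵇ true) →-dec (A ⊆? L) →-dec (v ∈? L))

  cl : Subset n → Subset n
  cl A = tabulate (does ∘ inClosure? A)

  ∈cl⇔ : ∀ {A v} → v ∈ cl A ⇔ InClosure A v
  ∈cl⇔ {A} {v} = mk⇔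
    (λ v∈ → does≡true⇒ (inClosure? A v) (trans (sym (lookup∘tabulate _ v)) ([]=⇒lookup v∈)))
    (λ v∈ → lookup⇒[]= v (cl A) (trans (lookup∘tabulate _ v) (dec-true (inClosure? A v) v∈)))

  cl-small : ∀ {A} → ∣ A ∣ < d → cl A ⊆ A
  cl-small ∣A∣<d v∈ with to ∈cl⇔ v∈
  ... | inj₁ (_ , v∈A) = v∈A
  ... | inj₂ (d≤∣A∣ , _) = contradiction d≤∣A∣ (<⇒≱ ∣A∣<d)

  cl-large : ∀ {A v} → d ≤ ∣ A ∣ → v ∈ cl A → ∀ L → 𝓛 L ≡ true → A ⊆ L → v ∈ L
  cl-large d≤∣A∣ v∈ with to ∈cl⇔ v∈
  ... | inj₁ (∣A∣<d , _) = contradiction d≤∣A∣ (<⇒≱ ∣A∣<d)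
  ... | inj₂ (_ , v∈⋂L) = v∈⋂L

  ∉cl⇒separated : ∀ {A v} → d ≤ ∣ A ∣ → v ∉ cl A → ∃ λ L → 𝓛 L ≡ true × A ⊆ L × v ∉ L
  ∉cl⇒separated {A} {v} d≤∣A∣ v∉cl
    with anySubset? (λ L → (𝓛 L ≟ᵇ true) ×-dec (A ⊆? L) ×-dec ¬? (v ∈? L))
  ... | yes separated = separated
  ... | no ∄L = contradiction (from ∈cl⇔ (inj₂ (d≤∣A∣ , v∈⋂L))) v∉cl
    where
    v∈⋂L : ∀ L → 𝓛 L ≡ true → A ⊆ L → v ∈ L
    v∈⋂L L L∈𝓛 A⊆L = decidable-stable (v ∈? L) (λ v∉L → ∄L (L , L∈𝓛 , A⊆L , v∉L))

  cl-extensive : ∀ {A} → A ⊆ cl A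
  cl-extensive {A} v∈A with ∣ A ∣ <? d
  ... | yes ∣A∣<d = from ∈cl⇔ (inj₁ (∣A∣<d , v∈A))
  ... | no ∣A∣≮d = from ∈cl⇔ (inj₂ (≮⇒≥ ∣A∣≮d , λ _ _ A⊆L → A⊆L v∈A))

  cl-monotone : ∀ {A B} → A ⊆ B → cl A ⊆ cl B
  cl-monotone {A} A⊆B v∈ with to ∈cl⇔ v∈
  ... | inj₁ (_ , v∈A) = cl-extensive (A⊆B v∈A)
  ... | inj₂ (d≤∣A∣ , v∈⋂L) = from ∈cl⇔
    (inj₂ (≤-trans d≤∣A∣ (p⊆q⇒∣p∣≤∣q∣ A⊆B) , λ L L∈𝓛 B⊆L → v∈⋂L L L∈𝓛 (B⊆L ∘ A⊆B)))

  cl-idempotent : ∀ {A} → cl (cl A) ⊆ cl A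
  cl-idempotent {A} with ∣ A ∣ <? d
  ... | yes ∣A∣<d = cl-monotone (cl-small ∣A∣<d)
  ... | no ∣A∣≮d = λ v∈ → from ∈cl⇔ (inj₂ (d≤∣A∣ , λ L L∈𝓛 A⊆L →
          cl-large d≤∣clA∣ v∈ L L∈𝓛 (λ u∈ → cl-large d≤∣A∣ u∈ L L∈𝓛 A⊆L)))
    where
    d≤∣A∣ : d ≤ ∣ A ∣
    d≤∣A∣ = ≮⇒≥ ∣A∣≮d
    d≤∣clA∣ : d ≤ ∣ cl A ∣
    d≤∣clA∣ = ≤-trans d≤∣A∣ (p⊆q⇒∣p∣≤∣q∣ cl-extensive)

  ∉cl⊥ : ∀ {v} → v ∉ cl ⊥
  ∉cl⊥ v∈ with to ∈cl⇔ v∈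
  ... | inj₁ (_ , v∈⊥) = ∉⊥ v∈⊥
  ... | inj₂ (d≤∣⊥∣ , _) = contradiction (≤-trans 1≤d (≤-trans d≤∣⊥∣ (≤-reflexive (∣⊥∣≡0 n)))) λ ()

  open ClosureComplex (nonempty S) cl cl-extensive cl-monotone cl-idempotent ∉cl⊥

  small⇒Independent : ∀ {X} → ∣ X ∣ ≤ d → Independent X
  small⇒Independent {X} = go X (⊂-wellFounded X)
    where
    go : ∀ X → Acc _⊂_ X → ∣ X ∣ ≤ d → Independent X
    go X (acc smaller) ∣X∣≤d with nonempty? X
    ... | no X-empty = empty X-empty
    ... | yes (x , x∈X) = step x∈X (x∉p-x ∘ cl-small ∣X-x∣<d)
                               (go (X - x) (smaller (x∈p⇒p-x⊂p x∈X)) (<⇒≤ ∣X-x∣<d))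
      where
      ∣X-x∣<d : ∣ X - x ∣ < d
      ∣X-x∣<d = <-≤-trans (x∈p⇒∣p-x∣<∣p∣ x∈X) ∣X∣≤d

  Independent⇒B : ∀ {X} → Independent X → ∣ X ∣ ≡ suc d → ∃ λ L → 𝓛 L ≡ true × ∣ X ∩ L ∣ ≡ d
  Independent⇒B (empty X-empty) ∣X∣≡ = contradiction (trans (sym ∣X∣≡) (Empty⇒∣p∣≡0 X-empty)) λ ()
  Independent⇒B (step x∈X x∉cl _) ∣X∣≡ =
    let ∣X-x∣≡d = x∈p∧∣p∣≡1+m⇒∣p-x∣≡m x∈X ∣X∣≡
        L , L∈𝓛 , X-x⊆L , x∉L = ∉cl⇒separated (≤-reflexive (sym ∣X-x∣≡d)) x∉cl
    in L , L∈𝓛 , trans (x∉q∧p-x⊆q⇒∣p∩q∣≡∣p-x∣ x∉L X-x⊆L) ∣X-x∣≡d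

  B⇒Independent : ∀ {L X} → 𝓛 L ≡ true → ∣ X ∣ ≡ suc d → ∣ X ∩ L ∣ ≡ d → Independent X
  B⇒Independent {L} L∈𝓛 ∣X∣≡ ∣X∩L∣≡ =
    let p , p∈X , p∉L , X-p⊆L = ∣p∣≡suc∣p∩q∣⇒∃x,p-x⊆q (trans ∣X∣≡ (cong suc (sym ∣X∩L∣≡)))
        ∣X-p∣≡d = x∈p∧∣p∣≡1+m⇒∣p-x∣≡m p∈X ∣X∣≡
    in step p∈X (λ p∈cl → p∉L (cl-large (≤-reflexive (sym ∣X-p∣≡d)) p∈cl L L∈𝓛 X-p⊆L))
            (small⇒Independent (≤-reflexive ∣X-p∣≡d))

  ℋ⇔Independent∧≤ : ∀ X → ℋ S X ≡ true ⇔ (ℋ complex X ≡ true × ∣ X ∣ ≤ suc d)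
  ℋ⇔Independent∧≤ X = mk⇔ independent bounded
    where
    independent : ℋ S X ≡ true → ℋ complex X ≡ true × ∣ X ∣ ≤ suc d
    independent X∈ℋ with to (ℋ⇔⋃B X) X∈ℋ
    ... | _ , _ , inj₁ ∣X∣≤d = from (ℋ⇔Independent X) (small⇒Independent ∣X∣≤d) , m≤n⇒m≤1+n ∣X∣≤d
    ... | _ , L∈𝓛 , inj₂ (∣X∣≡ , ∣X∩L∣≡) =
      from (ℋ⇔Independent X) (B⇒Independent L∈𝓛 ∣X∣≡ ∣X∩L∣≡) , ≤-reflexive ∣X∣≡
    bounded : ℋ complex X ≡ true × ∣ X ∣ ≤ suc d → ℋ S X ≡ true
    bounded (X∈ℋ′ , ∣X∣≤) with m≤n⇒m<n∨m≡n ∣X∣≤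
    ... | inj₁ (s≤s ∣X∣≤d) = from (ℋ⇔⋃B X) (L₀ , L₀∈𝓛 , inj₁ ∣X∣≤d)
    ... | inj₂ ∣X∣≡ = let L , L∈𝓛 , ∣X∩L∣≡ = Independent⇒B (to (ℋ⇔Independent X) X∈ℋ′) ∣X∣≡
                      in from (ℋ⇔⋃B X) (L , L∈𝓛 , inj₂ (∣X∣≡ , ∣X∩L∣≡))

  isTBRSC : IsTBRSC S
  isTBRSC = complex , suc d , s≤s z≤n , complex-IsBRSC , ⇔⇒IsTruncation S complex ℋ⇔Independent∧≤

theorem5p6 : ∀ {n : ℕ} (d : ℕ) (S : SimplicialComplex n) → 2 ≤ d →
    IsPavingDim S d → HasDim S d →
    (InTBPav d S ⇔ HasBDecomposition d S)
theorem5p6 d S 2≤d pav dim = mk⇔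
  (λ (_ , (S′ , K , _ , S′-brsc , trunc) , _) →
    TBRSC⇒BDecomposition.decomposition S pav dim S′ K S′-brsc trunc)
  (λ (𝓛 , (_ , L₀∈𝓛) , _ , ℋ⇔⋃B) →
    pav , BDecomposition⇒TBRSC.isTBRSC S (<⇒≤ 2≤d) 𝓛 L₀∈𝓛 ℋ⇔⋃B , dim)
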